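{- For any hypergraph $H$ and any $B\subseteq V(\mathrm{core}(H))$, $B$ is a lazy burning set for $\mathrm{core}(H)$ if and only if $B$ is a lazy burning set for $H$.
   Context: A hypergraph $H$ consists of a finite vertex set $V(H)$ and a finite collection $E(H)$ of nonempty subsets of $V(H)$. Lazy burning: a set $B\subseteq V(H)$ is burned initially; in each subsequent round every unburned vertex $v$ for which some hyperedge $h\ni v$ has $h\setminus\{v\}$ entirely burned becomes burned. $B$ is a lazy burning set if eventually all vertices burn. For $U\subseteq V(H)$, $H[U]$ has vertex set $U$ and hyperedges $\{h\cap U: h\in E(H),\ h\cap U\neq\emptyset\}$. The core $\mathrm{core}(H)$ is $H[U]$ for the largest $U\subseteq V(H)$ such that every hyperedge of $H[U]$ has cardinality at least $2$ (equivalently, obtained by repeatedly deleting the vertex of a singleton hyperedge until none remain). -}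

module Defs where

open import Data.Nat using (ℕ; zero; suc; _≤_)
open import Data.Fin using (Fin)
open import Data.Fin.Subset using (Subset; _∈_; _⊆_; _∩_; Nonempty; ∣_∣)
open import Data.Fin.Subset.Properties using (nonempty?)
open import Data.List using (List; map; filter)
open import Data.List.Relation.Unary.All using (All)
open import Data.List.Membership.Propositional renaming (_∈_ to _∈ₗ_)
open import Data.Product using (Σ; ∃; _×_; _,_)
open import Data.Sum using (_⊎_)
open import Relation.Binary.PropositionalEquality using (_≢_)

record HG (n : ℕ) : Set where
  constructor mkHG
  field
    V : Subset n
    E : List (Subset n)
open HG public

IsHypergraph : ∀ {n} → HG n → Set
IsHypergraph H = All Nonempty (E H) × All (_⊆ V H) (E H)

induced : ∀ {n} → HG n → Subset n → HG n
induced H U = mkHG U (filter nonempty? (map (_∩ U) (E H)))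

BurnedBy : ∀ {n} → HG n → Subset n → ℕ → Fin n → Set
BurnedBy H B zero v = v ∈ B
BurnedBy H B (suc k) v =
  BurnedBy H B k v ⊎
  Σ (Subset n) λ h → h ∈ₗ E H × v ∈ h × (∀ u → u ∈ h → u ≢ v → BurnedBy H B k u)
  where n = _

LazyBurningSet : ∀ {n} → HG n → Subset n → Set
LazyBurningSet H B = B ⊆ V H × ∃ λ k → ∀ v → v ∈ V H → BurnedBy H B k v

CoreCandidate : ∀ {n} → HG n → Subset n → Set
CoreCandidate H U = U ⊆ V H × All (λ h → 2 ≤ ∣ h ∣) (E (induced H U))

IsCoreVertexSet : ∀ {n} → HG n → Subset n → Set
IsCoreVertexSet H U = CoreCandidate H U × (∀ U' → CoreCandidate H U' → U' ⊆ U)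

-- Let X be the set burned in H from B after enough rounds that X is closed under the burning
-- rule.  Then W = (V(H) − X) ∪ core(H) induces a hypergraph without singleton edges: an edge
-- meeting W only in a vertex v outside the core has all its other vertices in X, so v would
-- burn.  Maximality of the core gives V(H) − X ⊆ core(H).  The traces h ∩ core(H) used when
-- burning in core(H) miss only vertices of X, so whatever core(H) burns lies in X, and a lazy
-- burning set of core(H) burns all of V(H).  Conversely, each burning step of H restricts to
-- one of core(H).

module Submission where

open import Defs
open import Data.Nat using (ℕ; zero; suc; _≤_; _<_; s≤s; z≤n)
open import Data.Nat.Properties using (≤-trans; <-≤-trans; n≮n)
open import Data.Bool.Properties using (T-≡)
open import Data.Fin using (Fin)
open import Data.Fin.Properties using (any?; all?) renaming (_≟_ to _≟ᶠ_)
open import Data.Fin.Subset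
open import Data.Fin.Subset.Properties
open import Data.Vec using (tabulate)
open import Data.Vec.Properties using (lookup∘tabulate; []=⇒lookup; lookup⇒[]=)
import Data.List.Relation.Unary.All as All
import Data.List.Relation.Unary.Any as Any
open import Data.List.Membership.Propositional using (find; lose) renaming (_∈_ to _∈ₗ_)
open import Data.List.Membership.Propositional.Properties using (∈-filter⁺; ∈-filter⁻; ∈-map⁺; ∈-map⁻)
open import Data.Product using (Σ; ∃; _×_; _,_; proj₁; proj₂)
open import Data.Sum using (_⊎_; inj₁; inj₂)
open import Function using (_∘_)
open import Function.Bundles using (_⇔_; mk⇔; Equivalence)
open import Relation.Nullary using (Dec; yes; no; ¬_; contradiction)
open import Relation.Nullary.Decidable using (_×-dec_; _→-dec_; ¬?; map′; ⌊_⌋; decidable-stable; toWitness; fromWitness)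
open import Relation.Binary.PropositionalEquality using (_≡_; _≢_; refl; sym; trans; subst)

private
  variable
    n : ℕ
    x y : Fin n
    p : Subset n

x∈p⇒0<∣p∣ : x ∈ p → 0 < ∣ p ∣
x∈p⇒0<∣p∣ {x = x} {p = p} x∈p =
  subst (_≤ ∣ p ∣) (∣⁅x⁆∣≡1 x) (p⊆q⇒∣p∣≤∣q∣ λ y∈⁅x⁆ → subst (_∈ p) (sym (x∈⁅y⁆⇒x≡y x y∈⁅x⁆)) x∈p)

x∈p∧y∈p∧x≢y⇒2≤∣p∣ : x ∈ p → y ∈ p → x ≢ y → 2 ≤ ∣ p ∣
x∈p∧y∈p∧x≢y⇒2≤∣p∣ x∈p y∈p x≢y =
  ≤-trans (s≤s (x∈p⇒0<∣p∣ (x∈p∧x≢y⇒x∈p-y y∈p (x≢y ∘ sym)))) (x∈p⇒∣p-x∣<∣p∣ x∈p)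

∃≢? : ∀ (p : Subset n) x → Dec (∃ λ y → y ∈ p × y ≢ x)
∃≢? p x = any? λ y → y ∈? p ×-dec ¬? (y ≟ᶠ x)

2≤∣p∣∧x∈p⇒∃≢ : 2 ≤ ∣ p ∣ → x ∈ p → ∃ λ y → y ∈ p × y ≢ x
2≤∣p∣∧x∈p⇒∃≢ {p = p} {x = x} 2≤∣p∣ x∈p = decidable-stable (∃≢? p x) λ none →
  contradiction (≤-trans 2≤∣p∣ (subst (∣ p ∣ ≤_) (∣⁅x⁆∣≡1 x) (p⊆q⇒∣p∣≤∣q∣ (p⊆⁅x⁆ none)))) λ { (s≤s ()) }
  where
  p⊆⁅x⁆ : ¬ (∃ λ y → y ∈ p × y ≢ x) → p ⊆ ⁅ x ⁆
  p⊆⁅x⁆ none {y} y∈p = decidable-stable (y ∈? ⁅ x ⁆) λ y∉⁅x⁆ → none (y , y∈p , x∉⁅y⁆⇒x≢y y∉⁅x⁆)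

Ignites : HG n → (Fin n → Set) → Fin n → Set
Ignites H P v = Σ (Subset _) λ h → h ∈ₗ E H × v ∈ h × (∀ u → u ∈ h → u ≢ v → P u)

Ignites-mono : ∀ {H : HG n} {P Q : Fin n → Set} {v} →
               (∀ {u} → P u → Q u) → Ignites H P v → Ignites H Q v
Ignites-mono P⇒Q (h , h∈E , v∈h , rest) = h , h∈E , v∈h , λ u u∈h u≢v → P⇒Q (rest u u∈h u≢v)

ignites? : ∀ (H : HG n) X v → Dec (Ignites H (_∈ X) v)
ignites? H X v = map′ find (λ (_ , h∈E , fires) → lose h∈E fires) (Any.any? fires? (E H))
  where
  fires? : ∀ h → Dec (v ∈ h × (∀ u → u ∈ h → u ≢ v → u ∈ X))
  fires? h = v ∈? h ×-dec all? λ u → u ∈? h →-dec (¬? (u ≟ᶠ v) →-dec u ∈? X)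

Closed : HG n → Subset n → Set
Closed H X = ∀ {v} → Ignites H (_∈ X) v → v ∈ X

BurnedBy⇒∈closed : ∀ {H : HG n} {B X} k {v} → B ⊆ X → Closed H X → BurnedBy H B k v → v ∈ X
BurnedBy⇒∈closed zero    B⊆X closed v∈B              = B⊆X v∈B
BurnedBy⇒∈closed (suc k) B⊆X closed (inj₁ burned)    = BurnedBy⇒∈closed k B⊆X closed burned
BurnedBy⇒∈closed {H = H} (suc k) B⊆X closed (inj₂ ignition) =
  closed (Ignites-mono {H = H} (BurnedBy⇒∈closed k B⊆X closed) ignition)

module _ (H : HG n) where

  ignited : Subset n → Subset n
  ignited X = tabulate λ v → ⌊ ignites? H X v ⌋

  ∈ignited⁺ : ∀ {X v} → Ignites H (_∈ X) v → v ∈ ignited X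
  ∈ignited⁺ {X} {v} ignition =
    lookup⇒[]= v _ (trans (lookup∘tabulate _ v) (Equivalence.to T-≡ (fromWitness {a? = ignites? H X v} ignition)))

  ∈ignited⁻ : ∀ {X v} → v ∈ ignited X → Ignites H (_∈ X) v
  ∈ignited⁻ {X} {v} v∈ =
    toWitness {a? = ignites? H X v} (Equivalence.from T-≡ (trans (sym (lookup∘tabulate _ v)) ([]=⇒lookup v∈)))

  step : Subset n → Subset n
  step X = X ∪ ignited X

  closed-or-grows : ∀ X → Closed H X ⊎ X ⊂ step X
  closed-or-grows X with any? (λ v → v ∈? ignited X ×-dec ¬? (v ∈? X))
  ... | yes (v , v∈ignited , v∉X) = inj₂ (p⊆p∪q (ignited X) , v , q⊆p∪q X (ignited X) v∈ignited , v∉X)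
  ... | no none = inj₁ λ {v} ignition →
    decidable-stable (v ∈? X) λ v∉X → none (v , ∈ignited⁺ ignition , v∉X)

  iterate : Subset n → ℕ → Subset n
  iterate B zero    = B
  iterate B (suc k) = step (iterate B k)

  B⊆iterate : ∀ B k → B ⊆ iterate B k
  B⊆iterate B zero    = λ v∈B → v∈B
  B⊆iterate B (suc k) = p⊆p∪q (ignited (iterate B k)) ∘ B⊆iterate B k

  iterate⇒BurnedBy : ∀ B k {v} → v ∈ iterate B k → BurnedBy H B k v
  iterate⇒BurnedBy B zero    v∈B = v∈B
  iterate⇒BurnedBy B (suc k) v∈step with x∈p∪q⁻ (iterate B k) (ignited (iterate B k)) v∈step
  ... | inj₁ v∈X       = inj₁ (iterate⇒BurnedBy B k v∈X)
  ... | inj₂ v∈ignited = inj₂ (Ignites-mono {H = H} (iterate⇒BurnedBy B k) (∈ignited⁻ v∈ignited))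

  closes-or-grows-to : ∀ B k → (∃ λ j → Closed H (iterate B j)) ⊎ k ≤ ∣ iterate B k ∣
  closes-or-grows-to B zero = inj₂ z≤n
  closes-or-grows-to B (suc k) with closes-or-grows-to B k
  ... | inj₁ closes = inj₁ closes
  ... | inj₂ k≤∣X∣ with closed-or-grows (iterate B k)
  ...   | inj₁ closed = inj₁ (k , closed)
  ...   | inj₂ X⊂step = inj₂ (<-≤-trans (s≤s k≤∣X∣) (p⊂q⇒∣p∣<∣q∣ X⊂step))

  iterate-closes : ∀ B → ∃ λ j → Closed H (iterate B j)
  iterate-closes B with closes-or-grows-to B (suc n)
  ... | inj₁ closes = closes
  ... | inj₂ n<∣X∣  = contradiction (≤-trans n<∣X∣ (∣p∣≤n (iterate B (suc n)))) (n≮n n)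

module _ {H : HG n} {U : Subset n} where

  ∈induced⁻ : ∀ {g} → g ∈ₗ E (induced H U) → ∃ λ h → h ∈ₗ E H × g ≡ h ∩ U × Nonempty g
  ∈induced⁻ g∈E with ∈-filter⁻ nonempty? g∈E
  ... | g∈map , nonempty with ∈-map⁻ (_∩ U) g∈map
  ...   | h , h∈E , refl = h , h∈E , refl , nonempty

  ∈induced⁺ : ∀ {h} → h ∈ₗ E H → Nonempty (h ∩ U) → h ∩ U ∈ₗ E (induced H U)
  ∈induced⁺ h∈E = ∈-filter⁺ nonempty? (∈-map⁺ (_∩ U) h∈E)

  BurnedBy-induced : ∀ {B} k {v} → v ∈ U → BurnedBy H B k v → BurnedBy (induced H U) B k v
  BurnedBy-induced zero    v∈U v∈B             = v∈B
  BurnedBy-induced (suc k) v∈U (inj₁ burned)   = inj₁ (BurnedBy-induced k v∈U burned)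
  BurnedBy-induced (suc k) v∈U (inj₂ (h , h∈E , v∈h , rest)) =
    inj₂ (h ∩ U , ∈induced⁺ h∈E (_ , v∈h∩U) , v∈h∩U , λ u u∈h∩U u≢v →
      let u∈h , u∈U = x∈p∩q⁻ h U u∈h∩U in BurnedBy-induced k u∈U (rest u u∈h u≢v))
    where
    v∈h∩U = x∈p∩q⁺ (v∈h , v∈U)

  induced-closed : ∀ {X} → All.All (_⊆ V H) (E H) → (∀ {v} → v ∈ V H → v ∉ U → v ∈ X) →
                   Closed H X → Closed (induced H U) X
  induced-closed {X} E⊆V outside⊆X closed (g , g∈E , v∈g , rest) with ∈induced⁻ g∈E
  ... | h , h∈E , refl , _ = closed (h , h∈E , proj₁ (x∈p∩q⁻ h U v∈g) , rest′)
    where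
    rest′ : ∀ u → u ∈ h → u ≢ _ → u ∈ X
    rest′ u u∈h u≢v with u ∈? U
    ... | yes u∈U = rest u (x∈p∩q⁺ (u∈h , u∈U)) u≢v
    ... | no  u∉U = outside⊆X (All.lookup E⊆V h∈E u∈h) u∉U

  candidate⇒∃≢ : CoreCandidate H U → ∀ {h v} → h ∈ₗ E H → v ∈ h ∩ U → ∃ λ u → u ∈ h ∩ U × u ≢ v
  candidate⇒∃≢ (_ , edges≥2) h∈E v∈h∩U =
    2≤∣p∣∧x∈p⇒∃≢ (All.lookup edges≥2 (∈induced⁺ h∈E (_ , v∈h∩U))) v∈h∩U

unburned∪candidate : ∀ {H : HG n} {X U} → All.All (_⊆ V H) (E H) → Closed H X →
                     CoreCandidate H U → CoreCandidate H ((V H ∩ ∁ X) ∪ U)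
unburned∪candidate {H = H} {X} {U} E⊆V closed candidate@(U⊆V , _) =
  W⊆V , All.tabulate λ g∈E → let h , h∈E , g≡h∩W , v , v∈g = ∈induced⁻ {H = H} {U = W} g∈E in
    subst (λ g → 2 ≤ ∣ g ∣) (sym g≡h∩W) (edge≥2 h∈E (subst (v ∈_) g≡h∩W v∈g))
  where
  W = (V H ∩ ∁ X) ∪ U

  W⊆V : W ⊆ V H
  W⊆V v∈W with x∈p∪q⁻ (V H ∩ ∁ X) U v∈W
  ... | inj₁ v∈V∖X = proj₁ (x∈p∩q⁻ (V H) (∁ X) v∈V∖X)
  ... | inj₂ v∈U   = U⊆V v∈U

  has-another : ∀ {h v} → h ∈ₗ E H → v ∈ h ∩ W → ¬ ¬ ∃ λ u → u ∈ h ∩ W × u ≢ v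
  has-another {h} {v} h∈E v∈h∩W none with x∈p∩q⁻ h W v∈h∩W
  ... | v∈h , v∈W with x∈p∪q⁻ (V H ∩ ∁ X) U v∈W
  ...   | inj₂ v∈U =
    let u , u∈h∩U , u≢v = candidate⇒∃≢ candidate h∈E (x∈p∩q⁺ (v∈h , v∈U))
        u∈h , u∈U = x∈p∩q⁻ h U u∈h∩U
    in none (u , x∈p∩q⁺ (u∈h , q⊆p∪q (V H ∩ ∁ X) U u∈U) , u≢v)
  ...   | inj₁ v∈V∖X =
    x∈∁p⇒x∉p (proj₂ (x∈p∩q⁻ (V H) (∁ X) v∈V∖X)) (closed (h , h∈E , v∈h , others-burned))
    where
    others-burned : ∀ u → u ∈ h → u ≢ v → u ∈ X
    others-burned u u∈h u≢v = decidable-stable (u ∈? X) λ u∉X →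
      none (u , x∈p∩q⁺ (u∈h , p⊆p∪q U (x∈p∩q⁺ (All.lookup E⊆V h∈E u∈h , x∉p⇒x∈∁p u∉X))) , u≢v)

  edge≥2 : ∀ {h v} → h ∈ₗ E H → v ∈ h ∩ W → 2 ≤ ∣ h ∩ W ∣
  edge≥2 {h} {v} h∈E v∈h∩W =
    let u , u∈h∩W , u≢v = decidable-stable (∃≢? (h ∩ W) v) (has-another h∈E v∈h∩W)
    in x∈p∧y∈p∧x≢y⇒2≤∣p∣ u∈h∩W v∈h∩W u≢v

outside-core⊆closed : ∀ {H : HG n} {X U} → All.All (_⊆ V H) (E H) → Closed H X →
                      IsCoreVertexSet H U → ∀ {v} → v ∈ V H → v ∉ U → v ∈ X
outside-core⊆closed {X = X} {U} E⊆V closed (candidate , maximal) {v} v∈V v∉U =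
  decidable-stable (v ∈? X) λ v∉X →
    v∉U (maximal _ (unburned∪candidate E⊆V closed candidate)
                   (p⊆p∪q U (x∈p∩q⁺ (v∈V , x∉p⇒x∈∁p v∉X))))

theorem3p6 : ∀ {n} (H : HG n) → IsHypergraph H →
    (U : Subset n) → IsCoreVertexSet H U →
    (B : Subset n) → B ⊆ U →
    (LazyBurningSet (induced H U) B ⇔ LazyBurningSet H B)
theorem3p6 H (_ , E⊆V) U core@((U⊆V , _) , _) B B⊆U = mk⇔ core⇒H H⇒core
  where
  H⇒core : LazyBurningSet H B → LazyBurningSet (induced H U) B
  H⇒core (_ , k , burns) = B⊆U , k , λ v v∈U → BurnedBy-induced k v∈U (burns v (U⊆V v∈U))

  core⇒H : LazyBurningSet (induced H U) B → LazyBurningSet H B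
  core⇒H (_ , k , burns) = U⊆V ∘ B⊆U , j , λ v v∈V → iterate⇒BurnedBy H B j (V⊆X v∈V)
    where
    j : ℕ
    j = proj₁ (iterate-closes H B)

    X : Subset _
    X = iterate H B j

    closed : Closed H X
    closed = proj₂ (iterate-closes H B)

    outside⊆X : ∀ {v} → v ∈ V H → v ∉ U → v ∈ X
    outside⊆X = outside-core⊆closed E⊆V closed core

    V⊆X : V H ⊆ X
    V⊆X {v} v∈V with v ∈? U
    ... | yes v∈U = BurnedBy⇒∈closed k (B⊆iterate H B j) (induced-closed E⊆V outside⊆X closed) (burns v v∈U)
    ... | no  v∉U = outside⊆X v∈V v∉U
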